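{- Let $\mathfrak{A}=32_{65}$ be the finite integral symmetric relation algebra with atoms $1',a,b,c$ (all self-converse), where for diversity atoms $x,y,z\in\{a,b,c\}$ we have $z\le x;y$ except exactly when $x=y=z=b$ or $x=y=z=c$ (and $1'\le x;y$ iff $x=y$). Then $\mathfrak{A}$ has a cyclic group representation over $\mathbb{Z}/p\mathbb{Z}$ for $p=751181$.
   Context: A cyclic group representation of a finite integral relation algebra over $\mathbb{Z}/n\mathbb{Z}$ is an assignment of a nonempty set $S_x\subseteq \mathbb{Z}/n\mathbb{Z}\setminus\{0\}$ to each diversity atom $x$ such that the sets $S_x$ partition $\mathbb{Z}/n\mathbb{Z}\setminus\{0\}$, $S_{\breve{x}}=-S_x$, and for all diversity atoms $x,y$, $(S_x+S_y)\setminus\{0\}=\bigcup\{S_z : z \text{ a diversity atom with } z\le x;y\}$. Equivalently, setting $R_{1'}=\{(u,u)\}$ and $R_x=\{(u,v): v-u\in S_x\}$ gives a representation of the algebra on the set $\mathbb{Z}/n\mathbb{Z}$. -}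

module Defs where

open import Data.Nat using (ℕ; suc; _+_; _∸_)
open import Data.Nat.DivMod using (_mod_)
open import Data.Fin using (Fin; toℕ; zero)
open import Data.Fin.Subset using (Subset; _∈_)
open import Data.Product using (Σ; ∃; _×_)
open import Relation.Binary.PropositionalEquality using (_≡_; _≢_)
open import Relation.Nullary using (¬_)
open import Function.Bundles using (_⇔_)

-- ℤ/nℤ with n = suc m, realised as Fin (suc m) with arithmetic mod n
ℤmod : ℕ → Set
ℤmod m = Fin (suc m)

_⊕_ : {m : ℕ} → ℤmod m → ℤmod m → ℤmod m
_⊕_ {m} u v = (toℕ u + toℕ v) mod (suc m)

⊖_ : {m : ℕ} → ℤmod m → ℤmod m
⊖_ {m} u = (suc m ∸ toℕ u) mod (suc m)

-- A finite integral relation algebra presented by its diversity atoms D,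
-- converse on D, and the cycle relation  Cyc x y z  meaning  z ≤ x ; y .
-- (1' ≤ x ; y  iff  y = x˘ holds automatically in an integral RA and is
-- not part of the cyclic-representation condition.)
record CyclicGroupRep (D : Set) (conv : D → D) (Cyc : D → D → D → Set)
                      (m : ℕ) : Set₁ where
  field
    S         : D → Subset (suc m)
    nonempty  : ∀ x → ∃ λ u → u ∈ S x
    zero∉     : ∀ x → ¬ (zero ∈ S x)
    cover     : ∀ (u : ℤmod m) → u ≢ zero → ∃ λ x → u ∈ S x
    disjoint  : ∀ x y (u : ℤmod m) → u ∈ S x → u ∈ S y → x ≡ y
    converse  : ∀ x (u : ℤmod m) → (u ∈ S (conv x)) ⇔ ((⊖ u) ∈ S x)
    compose   : ∀ x y (w : ℤmod m) → w ≢ zero →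
                (Σ (ℤmod m) λ u → Σ (ℤmod m) λ v → u ∈ S x × v ∈ S y × (u ⊕ v) ≡ w)
                ⇔ (∃ λ z → Cyc x y z × w ∈ S z)

data Atom : Set where
  a b c : Atom

conv₃₂₆₅ : Atom → Atom
conv₃₂₆₅ x = x

data Forbidden : Atom → Atom → Atom → Set where
  bbb : Forbidden b b b
  ccc : Forbidden c c c

Cyc₃₂₆₅ : Atom → Atom → Atom → Set
Cyc₃₂₆₅ x y z = ¬ Forbidden x y z

{-# OPTIONS --safe #-}

-- Let p = 751181 and χ x = x^6532 mod p. As p − 1 = 115 · 6532, the kernel H of χ on (ℤ/p)ˣ
-- has index 115; take S_b = H, S_c = 2H and S_a the union of the remaining 113 cosets. They are
-- symmetric because χ(−1) = 1. Since bbb and ccc are the only forbidden cycles, one inclusion of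
-- the composition law says that H and 2H are sum-free. If u + v = t in H, then h = v/u and
-- 1 + h = t/u both lie in H, which an exhaustive check over all residues rules out; 2H follows by
-- scaling with 2⁻¹. For the other inclusion, the class of wα depends only on χ w and χ α, so it
-- suffices to tabulate, for each of the 115 values of χ w and each allowed pair (x, y), one α
-- with wα ∈ S_x and w(1 − α) ∈ S_y.

module Submission where

open import Defs
open import Algebra.Properties.CommutativeSemigroup using (interchange)
open import Data.Bool using (Bool; true; false; _∧_; if_then_else_)
open import Data.Bool.Properties using (T-≡)
open import Data.Fin using (Fin; toℕ; zero; suc; #_)
import Data.Fin.Properties as Fin
open import Data.Fin.Properties using (toℕ-fromℕ<; toℕ-injective; toℕ<n)
open import Data.Fin.Subset using (Subset; _∈_)
open import Data.Maybe using (Maybe; just; nothing; Is-just)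
import Data.Maybe.Relation.Unary.All as Maybe using (All; just; nothing)
import Data.Maybe.Relation.Unary.Any as Maybe using (dec; just)
open import Data.Nat using (ℕ; suc; pred; _+_; _*_; _∸_; _^_; _%_; _≤_; _<_; _≡ᵇ_; _<ᵇ_; NonZero; s≤s; s<s⁻¹)
open import Data.Nat.Binary using (ℕᵇ; 2[1+_]; 1+[2_]) renaming (zero to 0ᵇ; toℕ to toℕᵇ)
open import Data.Nat.DivMod
open import Data.Nat.Properties
open import Data.Product using (∃; ∃₂; _×_; _,_; proj₁; proj₂)
open import Data.Sum using (_⊎_; inj₁; inj₂)
open import Data.Unit using (⊤; tt)
open import Data.Vec as Vec using (tabulate)
open import Data.Vec.Properties using (lookup∘tabulate; []=⇒lookup; lookup⇒[]=)
open import Function.Base using (_∘_)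
open import Function.Bundles using (_⇔_; mk⇔; Equivalence)
open import Relation.Binary.Definitions using (DecidableEquality)
open import Relation.Binary.PropositionalEquality
open import Relation.Nullary using (Dec; yes; no; does; ¬_; ¬?; _×-dec_; _→-dec_)
open import Relation.Nullary.Decidable using (dec-true; from-yes; map′)

open ≡-Reasoning

SumFree : (ℕ → Set) → Set
SumFree P = ∀ {u v} → P u → P v → ¬ P (u + v)

*-^ : ∀ x y k → (x * y) ^ k ≡ x ^ k * y ^ k
*-^ x y 0       = refl
*-^ x y (suc k) = begin
  x * y * (x * y) ^ k       ≡⟨ cong (x * y *_) (*-^ x y k) ⟩
  x * y * (x ^ k * y ^ k)   ≡⟨ interchange *-commutativeSemigroup x y (x ^ k) (y ^ k) ⟩
  x ^ suc k * y ^ suc k     ∎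

^-double : ∀ x k → x ^ (2 * k) ≡ x ^ k * x ^ k
^-double x k = trans (cong (λ j → x ^ (k + j)) (+-identityʳ k)) (^-distribˡ-+-* x k k)

[m∸k]+k*[1+m]≡m*[1+k] : ∀ {m k} → k ≤ m → (m ∸ k) + k * suc m ≡ m * suc k
[m∸k]+k*[1+m]≡m*[1+k] {m} {k} k≤m = begin
  (m ∸ k) + k * suc m    ≡⟨ cong ((m ∸ k) +_) (*-suc k m) ⟩
  (m ∸ k) + (k + k * m)  ≡⟨ +-assoc (m ∸ k) k (k * m) ⟨
  (m ∸ k) + k + k * m    ≡⟨ cong₂ _+_ (m∸n+n≡m k≤m) (*-comm k m) ⟩
  m + m * k              ≡⟨ *-suc m k ⟨
  m * suc k              ∎

-- Evaluated tail-recursively; Data.Nat.allUpTo? exhausts memory on 751181 residues.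
allBelow : {P : ℕ → Set} → (∀ h → Dec (P h)) → ℕ → Bool
allBelow P? 0       = true
allBelow P? (suc n) = does (P? n) ∧ allBelow P? n

allBelow-sound : ∀ {P : ℕ → Set} (P? : ∀ h → Dec (P h)) n →
                 allBelow P? n ≡ true → ∀ {h} → h < n → P h
allBelow-sound P? (suc n) all≡true {h} (s≤s h≤n) with P? n
... | yes Pn with h ≟ n
...   | yes refl = Pn
...   | no  h≢n  = allBelow-sound P? n all≡true (≤∧≢⇒< h≤n h≢n)
allBelow-sound P? (suc n) () _ | no _

module Modular (n : ℕ) .{{_ : NonZero n}} where

  %-*-% : ∀ x y → x % n * (y % n) % n ≡ x * y % n
  %-*-% x y = sym (%-distribˡ-* x y n)

  %-^ : ∀ x k → (x % n) ^ k % n ≡ x ^ k % n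
  %-^ x 0       = refl
  %-^ x (suc k) = begin
    x % n * (x % n) ^ k % n              ≡⟨ %-distribˡ-* (x % n) ((x % n) ^ k) n ⟩
    x % n % n * ((x % n) ^ k % n) % n    ≡⟨ cong₂ (λ s t → s * t % n) (m%n%n≡m%n x n) (%-^ x k) ⟩
    x % n * (x ^ k % n) % n              ≡⟨ %-*-% x (x ^ k) ⟩
    x * x ^ k % n                        ∎

  *-complement : ∀ w α → α ≤ suc n → (w * α + w * (suc n ∸ α)) % n ≡ w % n
  *-complement w α α≤1+n = begin
    (w * α + w * (suc n ∸ α)) % n   ≡⟨ cong (_% n) (*-distribˡ-+ w α (suc n ∸ α)) ⟨
    w * (α + (suc n ∸ α)) % n       ≡⟨ cong (λ t → w * t % n) (m+[n∸m]≡n α≤1+n) ⟩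
    w * suc n % n                   ≡⟨ cong (_% n) (*-suc w n) ⟩
    (w + w * n) % n                 ≡⟨ [m+kn]%n≡m%n w w n ⟩
    w % n                           ∎

  -- A separate function rather than a let, so that evaluation squares a shared value
  -- instead of computing it twice.
  sq : ℕ → ℕ
  sq r = r * r % n

  powMod : ℕ → ℕᵇ → ℕ
  powMod x 0ᵇ       = 1 % n
  powMod x 2[1+ e ] = sq (x % n * powMod x e % n)
  powMod x 1+[2 e ] = x % n * sq (powMod x e) % n

  powMod-correct : ∀ x e → powMod x e ≡ x ^ toℕᵇ e % n
  powMod-correct x 0ᵇ = refl
  powMod-correct x 2[1+ e ] = begin
    sq (x % n * powMod x e % n)    ≡⟨ cong (λ r → sq (x % n * r % n)) (powMod-correct x e) ⟩
    sq (x % n * (x ^ k % n) % n)   ≡⟨ cong sq (%-*-% x (x ^ k)) ⟩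
    sq (x ^ suc k % n)             ≡⟨ %-*-% (x ^ suc k) (x ^ suc k) ⟩
    x ^ suc k * x ^ suc k % n      ≡⟨ cong (_% n) (^-double x (suc k)) ⟨
    x ^ (2 * suc k) % n            ∎
    where k = toℕᵇ e
  powMod-correct x 1+[2 e ] = begin
    x % n * sq (powMod x e) % n      ≡⟨ cong (λ r → x % n * sq r % n) (powMod-correct x e) ⟩
    x % n * sq (x ^ k % n) % n       ≡⟨ cong (λ r → x % n * r % n) (%-*-% (x ^ k) (x ^ k)) ⟩
    x % n * (x ^ k * x ^ k % n) % n  ≡⟨ %-*-% x (x ^ k * x ^ k) ⟩
    x * (x ^ k * x ^ k) % n          ≡⟨ cong (λ t → x * t % n) (^-double x k) ⟨
    x ^ suc (2 * k) % n              ∎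
    where k = toℕᵇ e

module _ {m : ℕ} where

  private
    n : ℕ
    n = suc m

  toℕ-mod : ∀ x → toℕ (x mod n) ≡ x % n
  toℕ-mod x = toℕ-fromℕ< _

  toℕ-⊕ : ∀ (u v : ℤmod m) → toℕ (u ⊕ v) ≡ (toℕ u + toℕ v) % n
  toℕ-⊕ u v = toℕ-mod (toℕ u + toℕ v)

  toℕ-⊖ : ∀ (u : ℤmod m) → toℕ (⊖ u) ≡ (n ∸ toℕ u) % n
  toℕ-⊖ u = toℕ-mod (n ∸ toℕ u)

  ⊖-zero : ⊖_ {m} zero ≡ zero
  ⊖-zero = toℕ-injective (trans (toℕ-⊖ zero) (n%n≡0 n))

  ⊖-≢zero : ∀ {u : ℤmod m} → u ≢ zero → ⊖ u ≢ zero
  ⊖-≢zero {zero}  u≢0 _     = u≢0 refl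
  ⊖-≢zero {suc i} _   ⊖u≡0 = <⇒≱ i<m (m∸n≡0⇒m≤n (begin
    m ∸ toℕ i          ≡⟨ m<n⇒m%n≡m (s≤s (m∸n≤m m (toℕ i))) ⟨
    (m ∸ toℕ i) % n    ≡⟨ toℕ-⊖ (suc i) ⟨
    toℕ (⊖ suc i)      ≡⟨ cong toℕ ⊖u≡0 ⟩
    0                  ∎))
    where
    i<m : toℕ i < m
    i<m = s<s⁻¹ (toℕ<n (suc i))

  -- w·α + w·(1 − α) = w, with 1 − α represented by n + 1 − α.
  ⊕-complement : ∀ (w : ℤmod m) α → α ≤ suc n →
                 ((toℕ w * α) mod n) ⊕ ((toℕ w * (suc n ∸ α)) mod n) ≡ w
  ⊕-complement w α α≤1+n = toℕ-injective (begin
    toℕ (u ⊕ v)                            ≡⟨ toℕ-⊕ u v ⟩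
    (toℕ u + toℕ v) % n                    ≡⟨ cong₂ (λ s t → (s + t) % n) (toℕ-mod (W * α)) (toℕ-mod (W * β)) ⟩
    (W * α % n + W * β % n) % n            ≡⟨ %-distribˡ-+ (W * α) (W * β) n ⟨
    (W * α + W * β) % n                    ≡⟨ Modular.*-complement n W α α≤1+n ⟩
    W % n                                  ≡⟨ m<n⇒m%n≡m (toℕ<n w) ⟩
    W                                      ∎)
    where
    W β : ℕ
    W = toℕ w
    β = suc n ∸ α
    u v : ℤmod m
    u = (W * α) mod n
    v = (W * β) mod n

∈-tabulate-does : ∀ {n} {P : Fin n → Set} (P? : ∀ u → Dec (P u)) {u} →
                  u ∈ tabulate (does ∘ P?) ⇔ P u
∈-tabulate-does {P = P} P? {u} = mk⇔ to (λ Pu → lookup⇒[]= u _ (trans entry (dec-true (P? u) Pu)))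
  where
  entry : Vec.lookup (tabulate (does ∘ P?)) u ≡ does (P? u)
  entry = lookup∘tabulate (does ∘ P?) u
  to : u ∈ tabulate (does ∘ P?) → P u
  to u∈ with P? u | trans (sym entry) ([]=⇒lookup u∈)
  ... | yes Pu | _ = Pu

module PowerCharacter (m : ℕ) (e : ℕᵇ) where

  private
    n k : ℕ
    n = suc m
    k = toℕᵇ e

  open Modular n

  -- Opaque because unfolding powMod on a variable produces a term of size 2^(bits of e).
  opaque
    χ : ℕ → ℕ
    χ x = powMod x e

    χ≡ : ∀ x → χ x ≡ x ^ k % n
    χ≡ x = powMod-correct x e

  χ<n : ∀ x → χ x < n
  χ<n x = subst (_< n) (sym (χ≡ x)) (m%n<n (x ^ k) n)

  1*χ%n : ∀ x → 1 * χ x % n ≡ χ x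
  1*χ%n x = trans (cong (_% n) (*-identityˡ (χ x))) (m<n⇒m%n≡m (χ<n x))

  χ-1 : 1 < n → χ 1 ≡ 1
  χ-1 1<n = trans (χ≡ 1) (trans (cong (_% n) (^-zeroˡ k)) (m<n⇒m%n≡m 1<n))

  χ-% : ∀ x → χ (x % n) ≡ χ x
  χ-% x = begin
    χ (x % n)        ≡⟨ χ≡ (x % n) ⟩
    (x % n) ^ k % n  ≡⟨ %-^ x k ⟩
    x ^ k % n        ≡⟨ χ≡ x ⟨
    χ x              ∎

  χ-* : ∀ x y → χ (x * y) ≡ χ x * χ y % n
  χ-* x y = begin
    χ (x * y)                     ≡⟨ χ≡ (x * y) ⟩
    (x * y) ^ k % n               ≡⟨ cong (_% n) (*-^ x y k) ⟩
    x ^ k * y ^ k % n             ≡⟨ %-*-% (x ^ k) (y ^ k) ⟨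
    x ^ k % n * (y ^ k % n) % n   ≡⟨ cong₂ (λ s t → s * t % n) (χ≡ x) (χ≡ y) ⟨
    χ x * χ y % n                 ∎

  χ-*-≡1 : ∀ {x y} → χ x ≡ 1 → χ y ≡ 1 → χ (x * y) ≡ 1
  χ-*-≡1 {x} {y} χx≡1 χy≡1 = begin
    χ (x * y)       ≡⟨ χ-* x y ⟩
    χ x * χ y % n   ≡⟨ cong₂ (λ s t → s * t % n) χx≡1 χy≡1 ⟩
    1 % n           ≡⟨ m<n⇒m%n≡m (subst (_< n) χx≡1 (χ<n x)) ⟩
    1               ∎

  χ-⊕ : ∀ (u v : ℤmod m) → χ (toℕ (u ⊕ v)) ≡ χ (toℕ u + toℕ v)
  χ-⊕ u v = trans (cong χ (toℕ-⊕ u v)) (χ-% (toℕ u + toℕ v))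

  χ-scale : ∀ (w : ℤmod m) α → χ (toℕ ((toℕ w * α) mod n)) ≡ χ (toℕ w) * χ α % n
  χ-scale w α = trans (cong χ (toℕ-mod (toℕ w * α))) (trans (χ-% (toℕ w * α)) (χ-* (toℕ w) α))

  -- m represents −1, so the hypothesis says that χ is even.
  χ-⊖ : χ m ≡ 1 → ∀ (u : ℤmod m) → χ (toℕ (⊖ u)) ≡ χ (toℕ u)
  χ-⊖ χm≡1 u = trans (cong χ (toℕ-⊖ u)) (χ-negate (toℕ u) (toℕ<n u))
    where
    χ-negate : ∀ t → t < n → χ ((n ∸ t) % n) ≡ χ t
    χ-negate 0       _         = cong χ (n%n≡0 n)
    χ-negate (suc j) (s≤s j<m) = begin
      χ ((m ∸ j) % n)                ≡⟨ cong χ ([m+kn]%n≡m%n (m ∸ j) j n) ⟨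
      χ ((m ∸ j + j * n) % n)        ≡⟨ cong (λ t → χ (t % n)) ([m∸k]+k*[1+m]≡m*[1+k] (<⇒≤ j<m)) ⟩
      χ (m * suc j % n)              ≡⟨ χ-% (m * suc j) ⟩
      χ (m * suc j)                  ≡⟨ χ-* m (suc j) ⟩
      χ m * χ (suc j) % n            ≡⟨ cong (λ s → s * χ (suc j) % n) χm≡1 ⟩
      1 * χ (suc j) % n              ≡⟨ 1*χ%n (suc j) ⟩
      χ (suc j)                      ∎

  χ-0 : .{{NonZero k}} → χ 0 ≡ 0
  χ-0 = trans (χ≡ 0) (cong (λ j → 0 ^ j % n) (sym (suc-pred k)))

  -- If u, v and u + v lie in the kernel, then so do h = v·u⁻¹ and 1 + h = (u + v)·u⁻¹,
  -- where u⁻¹ = u^(k−1).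
  kernel-sumFree : .{{NonZero k}} → (∀ {h} → h < n → χ h ≡ 1 → χ (suc h) ≢ 1) →
                   SumFree (λ u → χ u ≡ 1)
  kernel-sumFree noConsecutive {u} {v} χu≡1 χv≡1 χ[u+v]≡1 =
    noConsecutive (m%n<n (v * i) n) (trans (χ-% (v * i)) (χ-*-≡1 χv≡1 χi≡1)) χ[1+h]≡1
    where
    i : ℕ
    i = u ^ pred k
    ui≡1 : u * i % n ≡ 1
    ui≡1 = begin
      u ^ suc (pred k) % n  ≡⟨ cong (λ j → u ^ j % n) (suc-pred k) ⟩
      u ^ k % n             ≡⟨ χ≡ u ⟨
      χ u                   ≡⟨ χu≡1 ⟩
      1                     ∎
    χi≡1 : χ i ≡ 1
    χi≡1 = begin
      χ i            ≡⟨ 1*χ%n i ⟨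
      1 * χ i % n    ≡⟨ cong (λ s → s * χ i % n) χu≡1 ⟨
      χ u * χ i % n  ≡⟨ χ-* u i ⟨
      χ (u * i)      ≡⟨ χ-% (u * i) ⟨
      χ (u * i % n)  ≡⟨ cong χ ui≡1 ⟩
      χ 1            ≡⟨ χ-1 (subst (_< n) χu≡1 (χ<n u)) ⟩
      1              ∎
    χ[1+h]≡1 : χ (suc (v * i % n)) ≡ 1
    χ[1+h]≡1 = begin
      χ (1 + v * i % n)              ≡⟨ χ-% (1 + v * i % n) ⟨
      χ ((1 + v * i % n) % n)        ≡⟨ cong (λ s → χ ((s + v * i % n) % n)) ui≡1 ⟨
      χ ((u * i % n + v * i % n) % n) ≡⟨ cong χ (%-distribˡ-+ (u * i) (v * i) n) ⟨
      χ ((u * i + v * i) % n)        ≡⟨ cong (λ s → χ (s % n)) (*-distribʳ-+ i u v) ⟨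
      χ ((u + v) * i % n)            ≡⟨ χ-% ((u + v) * i) ⟩
      χ ((u + v) * i)                ≡⟨ χ-*-≡1 χ[u+v]≡1 χi≡1 ⟩
      1                              ∎

  coset-sumFree : SumFree (λ u → χ u ≡ 1) → ∀ {g d} → d * g % n ≡ 1 → SumFree (λ u → χ u ≡ χ g)
  coset-sumFree kernelFree {g} {d} dg≡1 {u} {v} χu≡χg χv≡χg χ[u+v]≡χg =
    kernelFree (shift χu≡χg) (shift χv≡χg)
               (subst (λ t → χ t ≡ 1) (*-distribˡ-+ d u v) (shift χ[u+v]≡χg))
    where
    shift : ∀ {x} → χ x ≡ χ g → χ (d * x) ≡ 1
    shift {x} χx≡χg = begin
      χ (d * x)       ≡⟨ χ-* d x ⟩
      χ d * χ x % n   ≡⟨ cong (λ t → χ d * t % n) χx≡χg ⟩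
      χ d * χ g % n   ≡⟨ χ-* d g ⟨
      χ (d * g)       ≡⟨ χ-% (d * g) ⟨
      χ (d * g % n)   ≡⟨ cong χ dg≡1 ⟩
      χ 1             ≡⟨ χ-1 (subst (_< n) dg≡1 (m%n<n (d * g) n)) ⟩
      1               ∎

data SearchTree (A : Set) : Set where
  leaf : SearchTree A
  node : SearchTree A → ℕ → A → SearchTree A → SearchTree A

module _ {A : Set} where

  lookup : SearchTree A → ℕ → Maybe A
  lookup leaf           _ = nothing
  lookup (node l k v r) x =
    if x ≡ᵇ k then just v else if x <ᵇ k then lookup l x else lookup r x

  AllEntries : (ℕ → A → Set) → SearchTree A → Set
  AllEntries P leaf           = ⊤
  AllEntries P (node l k v r) = AllEntries P l × P k v × AllEntries P r

  allEntries? : ∀ {P : ℕ → A → Set} → (∀ k v → Dec (P k v)) → ∀ t → Dec (AllEntries P t)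
  allEntries? P? leaf           = yes tt
  allEntries? P? (node l k v r) = allEntries? P? l ×-dec P? k v ×-dec allEntries? P? r

  lookup⁺ : ∀ {P : ℕ → A → Set} t {x} → AllEntries P t → Maybe.All (P x) (lookup t x)
  lookup⁺ leaf _ = Maybe.nothing
  lookup⁺ {P} (node l k v r) {x} (Pl , Pk , Pr) with x ≡ᵇ k in x≡ᵇk
  ... | true  = Maybe.just (subst (λ y → P y v) (sym (≡ᵇ⇒≡ x k (Equivalence.from T-≡ x≡ᵇk))) Pk)
  ... | false with x <ᵇ k
  ...   | true  = lookup⁺ l Pl
  ...   | false = lookup⁺ r Pr

module Classification {D : Set} (_≟ᴰ_ : DecidableEquality D) (conv : D → D)
                      (Cyc : D → D → D → Set) {m : ℕ} (class : ℤmod m → D) where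

  Classified : D → ℤmod m → Set
  Classified x u = u ≢ zero × class u ≡ x

  classified? : ∀ x u → Dec (Classified x u)
  classified? x u = ¬? (u Fin.≟ zero) ×-dec class u ≟ᴰ x

  fibre : D → Subset (suc m)
  fibre x = tabulate (does ∘ classified? x)

  ∈-fibre : ∀ {x u} → u ∈ fibre x ⇔ Classified x u
  ∈-fibre {x} = ∈-tabulate-does (classified? x)

  open Equivalence

  cyclicGroupRep :
    (∀ x → conv (conv x) ≡ x) →
    (∀ x → ∃ (Classified x)) →
    (∀ u → u ≢ zero → class (⊖ u) ≡ conv (class u)) →
    (∀ {u v} → u ≢ zero → v ≢ zero → u ⊕ v ≢ zero → Cyc (class u) (class v) (class (u ⊕ v))) →
    (∀ x y w → w ≢ zero → Cyc x y (class w) →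
       ∃₂ λ u v → Classified x u × Classified y v × u ⊕ v ≡ w) →
    CyclicGroupRep D conv Cyc m
  cyclicGroupRep conv-involutive inhabited class-⊖ closed realised = record
    { S        = fibre
    ; nonempty = λ x → proj₁ (inhabited x) , from ∈-fibre (proj₂ (inhabited x))
    ; zero∉    = λ x 0∈ → proj₁ (to ∈-fibre 0∈) refl
    ; cover    = λ u u≢0 → class u , from ∈-fibre (u≢0 , refl)
    ; disjoint = λ x y u u∈x u∈y → trans (sym (proj₂ (to ∈-fibre u∈x))) (proj₂ (to ∈-fibre u∈y))
    ; converse = λ x u → mk⇔ (negate x u) (unnegate x u)
    ; compose  = λ x y w w≢0 → mk⇔ (sum⇒cycle w≢0) (cycle⇒sum x y w w≢0)
    }
    where
    negate : ∀ x u → u ∈ fibre (conv x) → ⊖ u ∈ fibre x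
    negate x u u∈ with to ∈-fibre u∈
    ... | u≢0 , class≡ = from ∈-fibre (⊖-≢zero u≢0 , (begin
      class (⊖ u)        ≡⟨ class-⊖ u u≢0 ⟩
      conv (class u)     ≡⟨ cong conv class≡ ⟩
      conv (conv x)      ≡⟨ conv-involutive x ⟩
      x                  ∎))

    unnegate : ∀ x u → ⊖ u ∈ fibre x → u ∈ fibre (conv x)
    unnegate x u ⊖u∈ with to ∈-fibre ⊖u∈
    ... | ⊖u≢0 , class≡ = from ∈-fibre (u≢0 , (begin
      class u                ≡⟨ conv-involutive (class u) ⟨
      conv (conv (class u))  ≡⟨ cong conv (class-⊖ u u≢0) ⟨
      conv (class (⊖ u))     ≡⟨ cong conv class≡ ⟩
      conv x                 ∎))
      where
      u≢0 : u ≢ zero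
      u≢0 refl = ⊖u≢0 ⊖-zero

    sum⇒cycle : ∀ {x y w} → w ≢ zero →
                (∃₂ λ u v → u ∈ fibre x × v ∈ fibre y × u ⊕ v ≡ w) →
                ∃ λ z → Cyc x y z × w ∈ fibre z
    sum⇒cycle w≢0 (u , v , u∈ , v∈ , refl) with to ∈-fibre u∈ | to ∈-fibre v∈
    ... | u≢0 , refl | v≢0 , refl = class (u ⊕ v) , closed u≢0 v≢0 w≢0 , from ∈-fibre (w≢0 , refl)

    cycle⇒sum : ∀ x y w → w ≢ zero → (∃ λ z → Cyc x y z × w ∈ fibre z) →
                ∃₂ λ u v → u ∈ fibre x × v ∈ fibre y × u ⊕ v ≡ w
    cycle⇒sum x y w w≢0 (z , cyc , w∈) with to ∈-fibre w∈
    ... | _ , refl with realised x y w w≢0 cyc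
    ...   | u , v , u∈x , v∈y , u⊕v≡w = u , v , from ∈-fibre u∈x , from ∈-fibre v∈y , u⊕v≡w

p : ℕ
p = 751181

-- 6532 in binary, where p − 1 = 115 · 6532.
exponent : ℕᵇ
exponent = 2[1+ 1+[2 2[1+ 1+[2 1+[2 1+[2 1+[2 2[1+ 2[1+ 1+[2 1+[2 2[1+ 0ᵇ ] ] ] ] ] ] ] ] ] ] ] ]

open PowerCharacter 751180 exponent

atomOf : ℕ → Atom
atomOf r with r ≟ 1 | r ≟ χ 2
... | yes _ | _     = b
... | no _  | yes _ = c
... | no _  | no _  = a

atomOf≡b : ∀ r → atomOf r ≡ b → r ≡ 1
atomOf≡b r with r ≟ 1 | r ≟ χ 2
... | yes r≡1 | _     = λ _ → r≡1
... | no _    | yes _ = λ ()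
... | no _    | no _  = λ ()

atomOf≡c : ∀ r → atomOf r ≡ c → r ≡ χ 2
atomOf≡c r with r ≟ 1 | r ≟ χ 2
... | yes _ | _        = λ ()
... | no _  | yes r≡χ2 = λ _ → r≡χ2
... | no _  | no _     = λ ()

class : ℤmod 751180 → Atom
class u = atomOf (χ (toℕ u))

_≟ᴬ_ : DecidableEquality Atom
a ≟ᴬ a = yes refl
a ≟ᴬ b = no λ ()
a ≟ᴬ c = no λ ()
b ≟ᴬ a = no λ ()
b ≟ᴬ b = yes refl
b ≟ᴬ c = no λ ()
c ≟ᴬ a = no λ ()
c ≟ᴬ b = no λ ()
c ≟ᴬ c = yes refl

∀-atom? : {P : Atom → Set} → (∀ x → Dec (P x)) → Dec (∀ x → P x)
∀-atom? P? = map′ (λ { (Pa , Pb , Pc) → λ { a → Pa ; b → Pb ; c → Pc } })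
                      (λ ∀P → ∀P a , ∀P b , ∀P c)
                      (P? a ×-dec P? b ×-dec P? c)

forbidden? : ∀ x y z → Dec (Forbidden x y z)
forbidden? a _ _ = no λ ()
forbidden? b a _ = no λ ()
forbidden? b b a = no λ ()
forbidden? b b b = yes bbb
forbidden? b b c = no λ ()
forbidden? b c _ = no λ ()
forbidden? c a _ = no λ ()
forbidden? c b _ = no λ ()
forbidden? c c a = no λ ()
forbidden? c c b = no λ ()
forbidden? c c c = yes ccc

forbidden-cases : ∀ {x y z} → Forbidden x y z → (x ≡ b × y ≡ b × z ≡ b) ⊎ (x ≡ c × y ≡ c × z ≡ c)
forbidden-cases bbb = inj₁ (refl , refl , refl)
forbidden-cases ccc = inj₂ (refl , refl , refl)

open Classification _≟ᴬ_ conv₃₂₆₅ Cyc₃₂₆₅ class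

ScalesInto : ℕ → ℕ → Atom → Set
ScalesInto r α x = r * χ α % p ≢ 0 × atomOf (r * χ α % p) ≡ x

Splits : ℕ → Atom → Atom → ℕ → Set
Splits r x y α = α < p × ScalesInto r α x × ScalesInto r (suc p ∸ α) y

Splitting : Set
Splitting = Atom → Atom → ℕ

ValidAt : ℕ → Splitting → Set
ValidAt r s = ∀ x y → Cyc₃₂₆₅ x y (atomOf r) → Splits r x y (s x y)

validAt? : ∀ r s → Dec (ValidAt r s)
validAt? r s = ∀-atom? λ x → ∀-atom? λ y → ¬? (forbidden? x y (atomOf r)) →-dec splits? x y (s x y)
  where
  scalesInto? : ∀ α x → Dec (ScalesInto r α x)
  scalesInto? α x = ¬? (r * χ α % p ≟ 0) ×-dec atomOf (r * χ α % p) ≟ᴬ x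
  splits? : ∀ x y α → Dec (Splits r x y α)
  splits? x y α = α <? p ×-dec scalesInto? α x ×-dec scalesInto? (suc p ∸ α) y

splitting : ℕ → ℕ → ℕ → ℕ → ℕ → ℕ → ℕ → ℕ → ℕ → Splitting
splitting aa ab ac ba bb bc ca cb cc = row (row aa ab ac) (row ba bb bc) (row ca cb cc)
  where
  row : {A : Set} → A → A → A → Atom → A
  row xa _  _  a = xa
  row _  xb _  b = xb
  row _  _  xc c = xc

-- Found by computer search; the entries for forbidden pairs are unused.
table : SearchTree Splitting
table =
  node
    (node
      (node
        (node
          (node
            (node
              (node leaf 1 (splitting 4 20 3 19 1 2104 38 2 69615) leaf)
              3391 (splitting 2 232 154 231 5223 8998 153 8433 9163)
              (node leaf 8948 (splitting 2 94 187 93 2794 6888 186 27211 6067) leaf))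
            14755 (splitting 2 69 94 68 37679 3091 93 5726 2794)
            (node
              (node leaf 16377 (splitting 2 109 217 108 368 30484 216 10410 39996) leaf)
              17423 (splitting 2 5 9 4 21951 3413 8 1610 467)
              (node leaf 19030 (splitting 2 55 109 54 27999 24317 108 824 368) leaf)))
          26774 (splitting 2 121 241 120 7086 6696 240 6431 21173)
          (node
            (node
              (node leaf 28065 (splitting 2 86 158 85 13787 5180 157 170 58250) leaf)
              31423 (splitting 2 76 78 75 2128 4967 77 30226 5823)
              (node leaf 34512 (splitting 2 49 34 48 2835 10566 33 1904 25824) leaf))
            39614 (splitting 2 92 183 91 4051 15791 182 5423 1860)
            (node
              (node leaf 45477 (splitting 2 12 23 11 1927 3729 22 2779 8146) leaf)
              51887 (splitting 2 14 27 13 11525 15283 26 4338 16523)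
              leaf)))
        55018 (splitting 2 4 7 3 18232 58831 6 45942 454)
        (node
          (node
            (node
              (node leaf 55486 (splitting 2 183 116 182 1860 9028 115 26551 17122) leaf)
              61101 (splitting 2 181 361 180 774 7141 360 34225 7386)
              (node leaf 66798 (splitting 2 27 53 26 16523 26963 52 2687 6819) leaf))
            71658 (splitting 2 13 25 12 9937 9045 24 1401 26669)
            (node
              (node leaf 77985 (splitting 2 139 56 80 4671 5140 55 81 6234) leaf)
              83805 (splitting 2 17 12 16 6825 13911 11 18419 1927)
              leaf))
          85752 (splitting 2 135 22 134 19655 22711 21 4329 5093)
          (node
            (node
              (node leaf 94695 (splitting 2 103 205 102 5852 6096 204 601 9740) leaf)
              98849 (splitting 2 24 47 23 6369 8545 46 2352 1576)
              (node leaf 119843 (splitting 2 125 249 124 16735 1997 248 6264 46898) leaf))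
            128055 (splitting 2 78 52 77 5823 1741 51 11277 11644)
            (node
              (node leaf 139246 (splitting 2 174 4 173 5887 808 3 17156 18232) leaf)
              149832 (splitting 2 245 98 244 45761 13919 97 2579 17644)
              leaf))))
      152645 (splitting 2 19 37 18 4526 16190 36 15969 12639)
      (node
        (node
          (node
            (node
              (node leaf 154486 (splitting 2 57 76 56 2614 11544 75 9628 2128) leaf)
              156236 (splitting 2 122 243 121 26749 19063 242 10574 4598)
              (node leaf 167688 (splitting 2 133 126 132 1405 4710 125 34733 3289) leaf))
            168961 (splitting 2 26 51 25 4056 28687 50 44035 509)
            (node
              (node leaf 170233 (splitting 2 98 26 97 17644 20440 25 21405 4056) leaf)
              172463 (splitting 2 198 188 186 6067 6434 372 187 7539)
              (node leaf 173044 (splitting 2 141 281 140 32098 38890 280 15306 1906) leaf)))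
          193840 (splitting 2 63 125 62 7117 12598 124 7400 16735)
          (node
            (node
              (node leaf 198344 (splitting 2 38 40 37 6106 3644 39 12821 18721) leaf)
              205578 (splitting 2 15 29 14 16034 416 28 11942 4621)
              (node leaf 208502 (splitting 2 47 28 46 1576 4378 27 47928 5359) leaf))
            213671 (splitting 6 3 5 2 69615 806 4 11136 21951)
            (node
              (node leaf 220402 (splitting 2 31 61 30 70113 21465 60 4997 5065) leaf)
              231166 (splitting 2 40 79 39 18721 59979 78 7640 9799)
              leaf)))
        231310 (splitting 2 126 190 125 3289 9420 189 4750 7907)
        (node
          (node
            (node
              (node leaf 236337 (splitting 2 16 31 15 1654 61083 30 26672 70113) leaf)
              242185 (splitting 2 105 8 104 22786 19347 7 6614 1965)
              (node leaf 258225 (splitting 2 441 38 440 24819 1892 37 49214 6106) leaf))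
            273150 (splitting 2 159 317 158 4600 7951 316 4543 13030)
            (node
              (node leaf 277509 (splitting 2 6 11 5 29901 17551 10 17094 817) leaf)
              281956 (splitting 2 37 73 36 12639 20638 72 32378 58276)
              leaf))
          285115 (splitting 2 190 86 189 7907 7713 85 8872 13787)
          (node
            (node
              (node leaf 288869 (splitting 2 217 106 216 39996 12829 105 4285 3358) leaf)
              295428 (splitting 2 62 123 61 2556 23966 122 26569 770)
              (node leaf 306971 (splitting 2 51 18 50 509 21104 17 7039 3882) leaf))
            314912 (splitting 2 79 68 78 9799 13596 67 18023 5751)
            (node
              (node leaf 353095 (splitting 2 73 36 72 58276 3858 35 13916 37851) leaf)
              356458 (splitting 2 53 105 52 6819 29602 104 5869 22786)
              leaf)))))
    357776 (splitting 2 67 133 66 2551 7690 132 14497 1405)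
    (node
      (node
        (node
          (node
            (node
              (node leaf 360815 (splitting 2 250 224 249 15459 8923 223 33515 2481) leaf)
              363133 (splitting 2 226 232 225 28835 2611 231 1475 5223)
              (node leaf 363767 (splitting 2 221 441 220 7659 17361 440 955 24819) leaf))
            382431 (splitting 2 32 63 31 24727 12808 62 8799 7117)
            (node
              (node leaf 402123 (splitting 2 11 21 10 817 32187 20 47533 1182) leaf)
              403215 (splitting 2 123 245 122 770 6623 244 17411 45761)
              (node leaf 406537 (splitting 2 188 24 187 7539 29984 23 11199 6369) leaf)))
          419877 (splitting 2 154 84 153 9163 12797 83 901 2042)
          (node
            (node
              (node leaf 435993 (splitting 2 56 111 55 6234 3446 110 320 27044) leaf)
              438391 (splitting 2 21 41 20 1182 37867 40 41971 11444)
              (node leaf 441518 (splitting 2 80 159 79 5238 17118 158 23341 4600) leaf))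
            456259 (splitting 2 376 62 375 15049 792 61 26241 2556)
            (node
              (node leaf 458772 (splitting 2 64 122 63 20689 804 121 10573 26749) leaf)
              472075 (splitting 2 10 19 9 12129 10973 18 342 4526)
              leaf)))
        474674 (splitting 2 317 250 316 13030 32306 249 5002 15459)
        (node
          (node
            (node
              (node leaf 476490 (splitting 2 61 121 60 5065 63955 120 17347 7086) leaf)
              486856 (splitting 2 89 64 88 27795 19553 63 72667 20689)
              (node leaf 489275 (splitting 2 84 167 83 2042 13000 166 17372 1803) leaf))
            492590 (splitting 2 48 10 47 7360 10879 9 1568 12129)
            (node
              (node leaf 493473 (splitting 2 224 46 223 2481 29363 45 1837 4960) leaf)
              497327 (splitting 2 238 92 237 20717 4000 91 4264 4051)
              leaf))
          513534 (splitting 2 91 181 90 1711 1785 180 530 774)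
          (node
            (node
              (node leaf 515110 (splitting 2 205 6 204 9740 4607 5 21007 29901) leaf)
              516393 (splitting 2 167 16 166 1803 26993 15 4012 1654)
              (node leaf 519609 (splitting 2 7 13 6 454 700 12 2916 9937) leaf))
            523877 (splitting 2 68 135 67 5751 10822 134 13058 19655)
            (node
              (node leaf 539275 (splitting 2 28 55 27 5359 42824 54 19438 27999) leaf)
              546829 (splitting 2 36 71 35 37851 8804 70 13691 10913)
              leaf))))
      552976 (splitting 2 71 141 70 10913 9291 140 7502 32098)
      (node
        (node
          (node
            (node
              (node leaf 554407 (splitting 2 8 15 7 1965 417 14 12464 16034) leaf)
              571065 (splitting 2 444 80 443 48248 2272 79 52427 5238)
              (node leaf 584039 (splitting 3 241 2 240 21173 13254 19 3318 1) leaf))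
            589832 (splitting 2 23 45 22 8146 22685 44 10561 46304)
            (node
              (node leaf 597137 (splitting 2 46 91 45 4960 855 90 22133 1711) leaf)
              597407 (splitting 2 111 221 110 27044 6619 220 22244 7659)
              (node leaf 600997 (splitting 2 45 89 44 46304 6645 88 6283 27795) leaf)))
          604523 (splitting 2 281 376 280 1906 13806 375 36215 15049)
          (node
            (node
              (node leaf 610564 (splitting 2 116 90 115 17122 16306 89 19002 37307) leaf)
              618716 (splitting 2 243 444 242 4598 4059 443 504 48248)
              (node leaf 620856 (splitting 2 34 67 33 25824 627 66 16152 2551) leaf))
            623161 (splitting 2 52 103 51 11644 5744 102 19665 5852)
            (node
              (node leaf 638872 (splitting 2 106 14 105 3358 1468 13 13958 11525) leaf)
              648914 (splitting 2 169 226 168 9002 20605 225 4275 28835)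
              leaf)))
        659821 (splitting 2 22 43 21 5093 3027 42 44185 3178)
        (node
          (node
            (node
              (node leaf 665376 (splitting 2 25 49 24 26669 28403 48 28129 2835) leaf)
              675023 (splitting 2 41 81 40 11444 14325 80 25481 4671)
              (node leaf 680345 (splitting 2 18 35 17 3882 580 34 65596 200) leaf))
            687978 (splitting 2 9 17 8 467 6826 16 10197 6825)
            (node
              (node leaf 698194 (splitting 2 35 69 34 200 23471 68 5073 37679) leaf)
              708845 (splitting 2 150 238 149 62914 16350 237 48708 20717)
              leaf))
          709268 (splitting 2 43 85 42 3178 7222 84 3428 4239)
          (node
            (node
              (node leaf 713812 (splitting 2 90 32 89 37307 28296 31 2988 24727) leaf)
              715725 (splitting 2 249 48 248 46898 11238 47 1327 7360)
              (node leaf 737172 (splitting 2 361 174 360 7386 6259 173 12163 5887) leaf))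
            738440 (splitting 2 85 169 84 4239 5694 168 6467 9002)
            (node
              (node leaf 747863 (splitting 2 29 57 28 4621 3061 56 13068 2614) leaf)
              749873 (splitting 2 158 150 157 58250 40065 149 2577 62914)
              leaf)))))

-- Used with r = χ h, passed separately so that χ h is evaluated once per residue.
ResidueOk : ℕ → ℕ → Set
ResidueOk h r = (h ≢ 0 → Is-just (lookup table r)) × (r ≡ 1 → χ (suc h) ≢ 1)

residueOk? : ∀ h r → Dec (ResidueOk h r)
residueOk? h r = (¬? (h ≟ 0) →-dec Maybe.dec (λ _ → yes tt) (lookup table r))
           ×-dec ((r ≟ 1) →-dec ¬? (χ (suc h) ≟ 1))

opaque
  unfolding χ

  χ[-1]≡1 : χ 751180 ≡ 1
  χ[-1]≡1 = refl

  inhabited : ∀ x → ∃ (Classified x)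
  inhabited a = # 4 , (λ ()) , refl
  inhabited b = # 1 , (λ ()) , refl
  inhabited c = # 2 , (λ ()) , refl

  table-valid : AllEntries ValidAt table
  table-valid = from-yes (allEntries? validAt? table)

  residues-ok : ∀ {h} → h < p → ResidueOk h (χ h)
  residues-ok = allBelow-sound (λ h → residueOk? h (χ h)) p refl

class-⊖ : ∀ u → u ≢ zero → class (⊖ u) ≡ class u
class-⊖ u _ = cong atomOf (χ-⊖ χ[-1]≡1 u)

kernel-free : SumFree (λ u → χ u ≡ 1)
kernel-free = kernel-sumFree (λ h<p → proj₂ (residues-ok h<p))

coset-free : SumFree (λ u → χ u ≡ χ 2)
coset-free = coset-sumFree kernel-free {g = 2} {d = 375591} refl

class-closed : ∀ {u v : ℤmod 751180} → u ≢ zero → v ≢ zero → u ⊕ v ≢ zero →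
               Cyc₃₂₆₅ (class u) (class v) (class (u ⊕ v))
class-closed {u} {v} _ _ _ forbidden with forbidden-cases forbidden
... | inj₁ (u∈b , v∈b , w∈b) =
  kernel-free (atomOf≡b _ u∈b) (atomOf≡b _ v∈b) (trans (sym (χ-⊕ u v)) (atomOf≡b _ w∈b))
... | inj₂ (u∈c , v∈c , w∈c) =
  coset-free (atomOf≡c _ u∈c) (atomOf≡c _ v∈c) (trans (sym (χ-⊕ u v)) (atomOf≡c _ w∈c))

splittingAt : ∀ (w : ℤmod 751180) → w ≢ zero → ∃ (ValidAt (χ (toℕ w)))
splittingAt w w≢0 =
  witness (proj₁ (residues-ok (toℕ<n w)) (w≢0 ∘ toℕ-injective)) (lookup⁺ {P = ValidAt} table table-valid)
  where
  witness : ∀ {r} {m : Maybe Splitting} → Is-just m → Maybe.All (ValidAt r) m → ∃ (ValidAt r)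
  witness (Maybe.just _) (Maybe.just valid) = _ , valid

scale-classified : ∀ (w : ℤmod 751180) {α x} → ScalesInto (χ (toℕ w)) α x →
                   Classified x ((toℕ w * α) mod p)
scale-classified w {α} (≢0 , atom≡x) =
  (λ wα≡0 → ≢0 (trans (sym (χ-scale w α)) (trans (cong (χ ∘ toℕ) wα≡0) χ-0))) ,
  trans (cong atomOf (χ-scale w α)) atom≡x

class-realised : ∀ x y w → w ≢ zero → Cyc₃₂₆₅ x y (class w) →
                 ∃₂ λ u v → Classified x u × Classified y v × u ⊕ v ≡ w
class-realised x y w w≢0 cyc with splittingAt w w≢0
... | s , valid with valid x y cyc
...   | α<p , into-x , into-y =
  _ , _ , scale-classified w into-x , scale-classified w into-y ,
  ⊕-complement w (s x y) (m≤n⇒m≤1+n (<⇒≤ α<p))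

mainTheorem2 : CyclicGroupRep Atom conv₃₂₆₅ Cyc₃₂₆₅ 751180
mainTheorem2 = cyclicGroupRep (λ _ → refl) inhabited class-⊖ class-closed class-realised
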